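{- Let $M$ be a mutual-visibility set of $Q_h$. Then $M$ is a dual mutual-visibility set of $Q_h$ if and only if for every $u,v \in V(Q_h)$ with $d(u,v)=2$ it holds that $|I(u,v)\cap M| \ne 2$, or $I(u,v)\cap M = \{w,z\}$ with $wz \in E(Q_h)$.
   Context: $Q_h$ is the hypercube with vertex set $\{0,1\}^h$, two strings adjacent iff they differ in exactly one position; $d$ is the graph distance and $I(u,v)$ is the set of vertices lying on some shortest $u,v$-path. For $M \subseteq V(G)$, a $u,v$-path is $M$-free if it contains no vertex of $M\setminus\{u,v\}$; $u,v$ are $M$-visible if there is an $M$-free shortest $u,v$-path. $M$ is a mutual-visibility set if every $u,v \in M$ are $M$-visible; $M$ is a dual mutual-visibility set if every $u,v\in M$ are $M$-visible and every $u,v\in V(G)\setminus M$ are $M$-visible. -}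

module Defs where

open import Data.Nat using (ℕ; zero; suc; _≤_)
open import Data.Bool using (Bool; true; false)
open import Data.Fin using (Fin)
open import Data.Vec using (Vec; lookup)
open import Data.Product using (Σ; ∃; ∃-syntax; _×_; _,_)
open import Data.Sum using (_⊎_)
open import Data.Unit using (⊤)
open import Relation.Nullary using (¬_)
open import Relation.Binary.PropositionalEquality using (_≡_; _≢_)
open import Function.Bundles using (_⇔_)

-- Vertices of the hypercube Q_h : binary strings of length h
V : ℕ → Set
V h = Vec Bool h

Adj : ∀ {h} → V h → V h → Set
Adj u v = ∃[ i ] (lookup u i ≢ lookup v i × (∀ j → j ≢ i → lookup u j ≡ lookup v j))

-- Walks from u to v in Q_h (shortest walks are exactly shortest paths)
data Walk {h : ℕ} : V h → V h → Set where
  []  : ∀ {u} → Walk u u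
  _∷_ : ∀ {u w v} → Adj u w → Walk w v → Walk u v

length : ∀ {h} {u v : V h} → Walk u v → ℕ
length []      = zero
length (_ ∷ p) = suc (length p)

On : ∀ {h} {u v : V h} → V h → Walk u v → Set
On {u = u} x []      = x ≡ u
On {u = u} x (_ ∷ p) = x ≡ u ⊎ On x p

VSet : ℕ → Set
VSet h = V h → Bool

_∈M_ : ∀ {h} → V h → VSet h → Set
x ∈M M = M x ≡ true

Shortest : ∀ {h} {u v : V h} → Walk u v → Set
Shortest {u = u} {v} p = (q : Walk u v) → length p ≤ length q

Dist : ∀ {h} → V h → V h → ℕ → Set
Dist u v n = Σ (Walk u v) λ p → length p ≡ n × Shortest p

-- internal vertices of the walk avoid M
Free : ∀ {h} → VSet h → {u v : V h} → Walk u v → Set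
Free M []                   = ⊤
Free M (_ ∷ [])             = ⊤
Free M (_∷_ {w = w} _ q@(_ ∷ _)) = M w ≡ false × Free M q

Visible : ∀ {h} → VSet h → V h → V h → Set
Visible M u v = Σ (Walk u v) λ p → Shortest p × Free M p

MutualVisibility : ∀ {h} → VSet h → Set
MutualVisibility M = ∀ u v → u ∈M M → v ∈M M → Visible M u v

DualMutualVisibility : ∀ {h} → VSet h → Set
DualMutualVisibility M =
  (∀ u v → u ∈M M → v ∈M M → Visible M u v) ×
  (∀ u v → M u ≡ false → M v ≡ false → Visible M u v)

InInterval : ∀ {h} → V h → V h → V h → Set
InInterval u v x = Σ (Walk u v) λ p → Shortest p × On x p

InIM : ∀ {h} → VSet h → V h → V h → V h → Set
InIM M u v x = InInterval u v x × x ∈M M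

HasTwo : ∀ {h} → (V h → Set) → Set
HasTwo {h} S = Σ (V h) λ w → Σ (V h) λ z →
  w ≢ z × (∀ x → S x ⇔ (x ≡ w ⊎ x ≡ z))

IsEdgePair : ∀ {h} → (V h → Set) → Set
IsEdgePair {h} S = Σ (V h) λ w → Σ (V h) λ z →
  Adj w z × (∀ x → S x ⇔ (x ≡ w ⊎ x ≡ z))

{-# OPTIONS --safe #-}
-- In Q_h the distance is the Hamming distance, and I(u,v) consists of the vertices keeping every
-- coordinate on which u and v agree; when d(u,v) = 2 it is a square u, a, b, v.
-- (⇒) A non-adjacent pair {w,z} = I(u,v) ∩ M would be a diagonal of the square I(w,z) ⊆ I(u,v);
-- the other diagonal then lies outside M, but every shortest path between its ends passes
-- through w or z.
-- (⇐) For u, v ∉ M with d(u,v) ≥ 2, let a and b be the neighbours of u and v in I(u,v) obtained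
-- by flipping the same coordinate. If both lie in M, then for d(u,v) = 2 the pair {a,b} violates
-- the condition, and for d(u,v) ≥ 3 an M-free shortest a,b-path has two consecutive interior
-- vertices in I(u,v) \ M, which cannot both be u and v. So I(u,v) has an interior vertex outside
-- M, and induction on d(u,v) glues M-free shortest paths through it.
module Submission where

open import Defs
open import Algebra.Properties.CommutativeSemigroup using (interchange)
open import Data.Bool using (Bool; true; false; not)
open import Data.Bool.Properties using (not-¬; ¬-not; not-injective; not-involutive)
import Data.Bool.Properties as Bool
open import Data.Empty using (⊥; ⊥-elim)
open import Data.Fin using (Fin; zero; suc)
open import Data.Fin.Properties using (all?; ¬∀⟶∃¬)
import Data.Fin.Properties as Fin
open import Data.List using (List; []; _∷_)
open import Data.List.Membership.Propositional using (_∈_)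
open import Data.List.Relation.Unary.Any using (here; there)
open import Data.Nat using (ℕ; zero; suc; _+_; _≤_; _<_; z≤n; s≤s)
open import Data.Nat.Induction using (<-rec)
open import Data.Nat.Properties
  using (+-suc; +-commutativeSemigroup; +-mono-≤; ≤-refl; ≤-reflexive; ≤-trans; ≤-antisym; ≤∧≢⇒<;
         n<1+n; 1+n≰n; 1+n≢0; <⇒≱; suc-injective; m+n≡0⇒m≡0; m+n≡0⇒n≡0; m≤n+m; m<m+n; m<n+m;
         n≢0⇒n>0; ≰⇒>; m≤n⇒m<n∨m≡n; _≤?_; module ≤-Reasoning)
import Data.Nat.Properties as ℕ
open import Data.Product using (Σ; ∃; ∃₂; _×_; _,_; proj₁; proj₂)
open import Data.Sum using (_⊎_; inj₁; inj₂; [_,_]′)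
import Data.Sum as Sum
open import Data.Vec using ([]; _∷_; lookup; updateAt)
open import Data.Vec.Properties
  using (lookup∘updateAt; lookup∘updateAt′; updateAt-updateAt; updateAt-id-local;
         tabulate∘lookup; tabulate-cong; ≡-dec)
open import Function.Base using (_∘_; id; case_of_)
open import Function.Bundles using (_⇔_; mk⇔; Equivalence)
import Function.Properties.Equivalence as ⇔
open import Relation.Binary.Definitions using (DecidableEquality)
open import Relation.Binary.PropositionalEquality
open import Relation.Nullary using (¬_; Dec; yes; no; contradiction; map′; _×-dec_; _→-dec_; ¬?)
open import Relation.Unary using (Decidable)

open Equivalence using (to; from)

data Cardinality {A : Set} (S : A → Set) : Set where
  none : (∀ x → ¬ S x) → Cardinality S
  one  : ∀ w → (∀ x → S x ⇔ x ≡ w) → Cardinality S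
  two  : ∀ w z → w ≢ z → (∀ x → S x ⇔ (x ≡ w ⊎ x ≡ z)) → Cardinality S
  many : ∀ x y z → S x → S y → S z → x ≢ y → x ≢ z → y ≢ z → Cardinality S

module _ {A : Set} where

  Cardinality-resp : {S T : A → Set} → (∀ x → S x ⇔ T x) → Cardinality S → Cardinality T
  Cardinality-resp S⇔T (none ∅)           = none λ x tx → ∅ x (from (S⇔T x) tx)
  Cardinality-resp S⇔T (one w S⇔w)        = one w λ x → ⇔.trans (⇔.sym (S⇔T x)) (S⇔w x)
  Cardinality-resp S⇔T (two w z w≢z S⇔wz) = two w z w≢z λ x → ⇔.trans (⇔.sym (S⇔T x)) (S⇔wz x)
  Cardinality-resp S⇔T (many x y z sx sy sz x≢y x≢z y≢z) =
    many x y z (to (S⇔T x) sx) (to (S⇔T y) sy) (to (S⇔T z) sz) x≢y x≢z y≢z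

  cardinality : DecidableEquality A → (S : A → Set) → Decidable S →
                (L : List A) → (∀ x → S x → x ∈ L) → Cardinality S
  cardinality _≟_ S S? []      S⊆L = none λ x sx → case S⊆L x sx of λ ()
  cardinality _≟_ S S? (y ∷ L) S⊆L = insert (S? y) (cardinality _≟_ S′ S′? L S′⊆L)
    where
    S′ : A → Set
    S′ x = S x × x ≢ y
    S′? : Decidable S′
    S′? x = S? x ×-dec ¬? (x ≟ y)
    S′⊆L : ∀ x → S′ x → x ∈ L
    S′⊆L x (sx , x≢y) with S⊆L x sx
    ... | here x≡y  = contradiction x≡y x≢y
    ... | there x∈L = x∈L
    y-or-S′ : ∀ x → S x → x ≡ y ⊎ S′ x
    y-or-S′ x sx with x ≟ y
    ... | yes x≡y = inj₁ x≡y
    ... | no x≢y  = inj₂ (sx , x≢y)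
    insert : Dec (S y) → Cardinality S′ → Cardinality S
    insert (no ¬sy) c = Cardinality-resp (λ x → mk⇔ proj₁ λ sx → sx , λ x≡y → ¬sy (subst S x≡y sx)) c
    insert (yes sy) (none ∅) =
      one y λ x → mk⇔ (λ sx → [ id , (λ s′x → contradiction s′x (∅ x)) ]′ (y-or-S′ x sx))
                      (λ x≡y → subst S (sym x≡y) sy)
    insert (yes sy) (one w S′⇔w) =
      two y w (λ y≡w → proj₂ (from (S′⇔w y) y≡w) refl) λ x →
        mk⇔ (λ sx → Sum.map₂ (to (S′⇔w x)) (y-or-S′ x sx))
            [ (λ x≡y → subst S (sym x≡y) sy) , (λ x≡w → proj₁ (from (S′⇔w x) x≡w)) ]′
    insert (yes sy) (two w z w≢z S′⇔wz) =
      many y w z sy (proj₁ s′w) (proj₁ s′z) (≢-sym (proj₂ s′w)) (≢-sym (proj₂ s′z)) w≢z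
      where
      s′w = from (S′⇔wz w) (inj₁ refl)
      s′z = from (S′⇔wz z) (inj₂ refl)
    insert (yes _) (many x₁ x₂ x₃ s₁ s₂ s₃ x₁≢x₂ x₁≢x₃ x₂≢x₃) =
      many x₁ x₂ x₃ (proj₁ s₁) (proj₁ s₂) (proj₁ s₃) x₁≢x₂ x₁≢x₃ x₂≢x₃

  three-not-in-pair : ∀ {a b x y z : A} → x ≡ a ⊎ x ≡ b → y ≡ a ⊎ y ≡ b → z ≡ a ⊎ z ≡ b →
                      x ≢ y → x ≢ z → y ≢ z → ⊥
  three-not-in-pair (inj₁ p) (inj₁ q) _        x≢y _   _   = x≢y (trans p (sym q))
  three-not-in-pair (inj₂ p) (inj₂ q) _        x≢y _   _   = x≢y (trans p (sym q))
  three-not-in-pair (inj₁ p) (inj₂ _) (inj₁ r) _   x≢z _   = x≢z (trans p (sym r))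
  three-not-in-pair (inj₂ p) (inj₁ _) (inj₂ r) _   x≢z _   = x≢z (trans p (sym r))
  three-not-in-pair (inj₁ _) (inj₂ q) (inj₂ r) _   _   y≢z = y≢z (trans q (sym r))
  three-not-in-pair (inj₂ _) (inj₁ q) (inj₁ r) _   _   y≢z = y≢z (trans q (sym r))

private variable
  h : ℕ
  u v w x y z : V h

hasTwo? : {S : V h → Set} → Cardinality S → Dec (HasTwo S)
hasTwo? (none ∅) = no λ (w , _ , _ , S⇔) → ∅ w (from (S⇔ w) (inj₁ refl))
hasTwo? (one c S⇔c) = no λ (w , z , w≢z , S⇔) →
  w≢z (trans (to (S⇔c w) (from (S⇔ w) (inj₁ refl))) (sym (to (S⇔c z) (from (S⇔ z) (inj₂ refl)))))
hasTwo? (two w z w≢z S⇔) = yes (w , z , w≢z , S⇔)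
hasTwo? (many x y z sx sy sz x≢y x≢z y≢z) = no λ (_ , _ , _ , S⇔) →
  three-not-in-pair (to (S⇔ x) sx) (to (S⇔ y) sy) (to (S⇔ z) sz) x≢y x≢z y≢z

_≟ᵥ_ : DecidableEquality (V h)
_≟ᵥ_ = ≡-dec Bool._≟_

lookup-ext : (∀ i → lookup u i ≡ lookup v i) → u ≡ v
lookup-ext {u = u} {v} eq = trans (sym (tabulate∘lookup u)) (trans (tabulate-cong eq) (tabulate∘lookup v))

differing-coordinate : u ≢ v → ∃ λ i → lookup u i ≢ lookup v i
differing-coordinate {u = u} {v} u≢v =
  ¬∀⟶∃¬ _ _ (λ i → lookup u i Bool.≟ lookup v i) (u≢v ∘ lookup-ext)

flipAt : V h → Fin h → V h
flipAt u i = updateAt u i not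

flipAt-involutive : ∀ (u : V h) i → flipAt (flipAt u i) i ≡ u
flipAt-involutive u i = trans (updateAt-updateAt i u) (updateAt-id-local i u (not-involutive (lookup u i)))

δ : Bool → Bool → ℕ
δ false false = 0
δ true  true  = 0
δ false true  = 1
δ true  false = 1

δ-refl : ∀ a → δ a a ≡ 0
δ-refl false = refl
δ-refl true  = refl

δ≡0⇒≡ : ∀ {a b} → δ a b ≡ 0 → a ≡ b
δ≡0⇒≡ {false} {false} _ = refl
δ≡0⇒≡ {true}  {true}  _ = refl

δ-not-≢ : ∀ {a b} → a ≢ b → δ a b ≡ suc (δ (not a) b)
δ-not-≢ {false} {false} a≢b = contradiction refl a≢b
δ-not-≢ {false} {true}  _   = refl
δ-not-≢ {true}  {false} _   = refl
δ-not-≢ {true}  {true}  a≢b = contradiction refl a≢b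

δ-not-≡ : ∀ a → δ (not a) a ≡ suc (δ a a)
δ-not-≡ false = refl
δ-not-≡ true  = refl

δ-not-not : ∀ a b → δ (not a) (not b) ≡ δ a b
δ-not-not false false = refl
δ-not-not false true  = refl
δ-not-not true  false = refl
δ-not-not true  true  = refl

δ-between : ∀ a b c → (a ≡ b → c ≡ a) → δ a c + δ c b ≡ δ a b
δ-between false false false _   = refl
δ-between true  true  true  _   = refl
δ-between false false true  c≡a = contradiction (c≡a refl) λ ()
δ-between true  true  false c≡a = contradiction (c≡a refl) λ ()
δ-between false true  false _   = refl
δ-between false true  true  _   = refl
δ-between true  false false _   = refl
δ-between true  false true  _   = refl

δ-between≤ : ∀ a b c d → (a ≡ b → c ≡ a) → (a ≡ b → d ≡ a) → δ c d ≤ δ a b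
δ-between≤ false false c     d     c≡a d≡a rewrite c≡a refl | d≡a refl = z≤n
δ-between≤ true  true  c     d     c≡a d≡a rewrite c≡a refl | d≡a refl = z≤n
δ-between≤ false true  false false _   _   = z≤n
δ-between≤ false true  true  true  _   _   = z≤n
δ-between≤ false true  false true  _   _   = ≤-refl
δ-between≤ false true  true  false _   _   = ≤-refl
δ-between≤ true  false false false _   _   = z≤n
δ-between≤ true  false true  true  _   _   = z≤n
δ-between≤ true  false false true  _   _   = ≤-refl
δ-between≤ true  false true  false _   _   = ≤-refl

hamming : V h → V h → ℕ
hamming []      []      = 0
hamming (a ∷ u) (b ∷ v) = δ a b + hamming u v

hamming-refl : (u : V h) → hamming u u ≡ 0
hamming-refl []      = refl
hamming-refl (a ∷ u) = cong₂ _+_ (δ-refl a) (hamming-refl u)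

hamming≡0⇒≡ : ∀ (u v : V h) → hamming u v ≡ 0 → u ≡ v
hamming≡0⇒≡ []      []      _   = refl
hamming≡0⇒≡ (a ∷ u) (b ∷ v) d≡0 =
  cong₂ _∷_ (δ≡0⇒≡ (m+n≡0⇒m≡0 (δ a b) d≡0)) (hamming≡0⇒≡ u v (m+n≡0⇒n≡0 (δ a b) d≡0))

hamming-flipAt-≢ : ∀ (u v : V h) i → lookup u i ≢ lookup v i → hamming u v ≡ suc (hamming (flipAt u i) v)
hamming-flipAt-≢ (a ∷ u) (b ∷ v) zero    a≢b = cong (_+ hamming u v) (δ-not-≢ a≢b)
hamming-flipAt-≢ (a ∷ u) (b ∷ v) (suc i) ne  =
  trans (cong (δ a b +_) (hamming-flipAt-≢ u v i ne)) (+-suc (δ a b) _)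

hamming-flipAt-≡ : ∀ (u v : V h) i → lookup u i ≡ lookup v i → hamming (flipAt u i) v ≡ suc (hamming u v)
hamming-flipAt-≡ (a ∷ u) (.a ∷ v) zero    refl = cong (_+ hamming u v) (δ-not-≡ a)
hamming-flipAt-≡ (a ∷ u) (b ∷ v)  (suc i) eq   =
  trans (cong (δ a b +_) (hamming-flipAt-≡ u v i eq)) (+-suc (δ a b) _)

hamming-flipAt-flipAt : ∀ (u v : V h) i → hamming (flipAt u i) (flipAt v i) ≡ hamming u v
hamming-flipAt-flipAt (a ∷ u) (b ∷ v) zero    = cong (_+ hamming u v) (δ-not-not a b)
hamming-flipAt-flipAt (a ∷ u) (b ∷ v) (suc i) = cong (δ a b +_) (hamming-flipAt-flipAt u v i)

Adj-flipAt : ∀ (u : V h) i → Adj u (flipAt u i)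
Adj-flipAt u i =
  i , (λ e → not-¬ refl (trans e (lookup∘updateAt i u))) , λ j j≢i → sym (lookup∘updateAt′ j i j≢i u)

Adj⇒flipAt : Adj u w → ∃ λ i → w ≡ flipAt u i
Adj⇒flipAt {u = u} {w} (i , differs , agrees) = i , lookup-ext agree
  where
  agree : ∀ j → lookup w j ≡ lookup (flipAt u i) j
  agree j with j Fin.≟ i
  ... | yes refl = trans (¬-not (differs ∘ sym)) (sym (lookup∘updateAt i u))
  ... | no j≢i   = trans (sym (agrees j j≢i)) (sym (lookup∘updateAt′ j i j≢i u))

Adj-sym : Adj u w → Adj w u
Adj-sym (i , differs , agrees) = i , differs ∘ sym , λ j j≢i → sym (agrees j j≢i)

Adj⇒≢ : Adj u w → u ≢ w
Adj⇒≢ (_ , differs , _) refl = differs refl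

Adj⇒hamming≡1 : Adj u w → hamming u w ≡ 1
Adj⇒hamming≡1 {u = u} {w} adj@(i , differs , _) = begin
  hamming u w                  ≡⟨ hamming-flipAt-≢ u w i differs ⟩
  suc (hamming (flipAt u i) w) ≡⟨ cong (λ t → suc (hamming t w)) (sym w≡flip) ⟩
  suc (hamming w w)            ≡⟨ cong suc (hamming-refl w) ⟩
  1                            ∎
  where
  open ≡-Reasoning
  w≡flip : w ≡ flipAt u i
  w≡flip = proj₂ (Adj⇒flipAt {u = u} {w} adj)

hamming≡1⇒Adj : hamming u w ≡ 1 → Adj u w
hamming≡1⇒Adj {u = u} {w} d≡1 = subst (Adj u) flip≡w (Adj-flipAt u i)
  where
  u≢w : u ≢ w
  u≢w refl = 1+n≢0 (trans (sym d≡1) (hamming-refl u))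
  i = proj₁ (differing-coordinate u≢w)
  flip≡w : flipAt u i ≡ w
  flip≡w = hamming≡0⇒≡ (flipAt u i) w
    (suc-injective (trans (sym (hamming-flipAt-≢ u w i (proj₂ (differing-coordinate u≢w)))) d≡1))

adjacent? : (u w : V h) → Dec (Adj u w)
adjacent? u w = map′ (hamming≡1⇒Adj {u = u} {w}) (Adj⇒hamming≡1 {u = u} {w}) (hamming u w ℕ.≟ 1)

2≤hamming⇒¬Adj : 2 ≤ hamming u v → ¬ Adj u v
2≤hamming⇒¬Adj {u = u} {v} 2≤d adj = 1+n≰n (subst (2 ≤_) (Adj⇒hamming≡1 {u = u} {v} adj) 2≤d)

hamming-Adj≤ : Adj u w → hamming u v ≤ suc (hamming w v)
hamming-Adj≤ {u = u} {w} {v} adj with Adj⇒flipAt {u = u} {w} adj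
... | i , refl with lookup u i Bool.≟ lookup v i
...   | no differs = ≤-reflexive (hamming-flipAt-≢ u v i differs)
...   | yes same   = subst (hamming u v ≤_) (cong suc (sym (hamming-flipAt-≡ u v i same))) (m≤n+m _ 2)

record Between (u v x : V h) : Set where
  constructor between
  field agrees : ∀ j → lookup u j ≡ lookup v j → lookup x j ≡ lookup u j

open Between

between? : (u v x : V h) → Dec (Between u v x)
between? u v x =
  map′ between agrees (all? λ j → (lookup u j Bool.≟ lookup v j) →-dec (lookup x j Bool.≟ lookup u j))

between-left : Between u v u
between-left = between λ _ _ → refl

between-right : Between u v v
between-right = between λ _ u≡v → sym u≡v

between-sym : Between u v x → Between v u x
between-sym (between x∈I) = between λ j v≡u → trans (x∈I j (sym v≡u)) (sym v≡u)

between-convex : Between u v x → Between u v y → Between x y z → Between u v z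
between-convex (between x∈I) (between y∈I) (between z∈J) =
  between λ j u≡v → trans (z∈J j (trans (x∈I j u≡v) (sym (y∈I j u≡v)))) (x∈I j u≡v)

between-flipAt : ∀ i → lookup u i ≢ lookup v i → Between u v (flipAt u i)
between-flipAt {u = u} {v} i differs = between agree
  where
  agree : ∀ j → lookup u j ≡ lookup v j → lookup (flipAt u i) j ≡ lookup u j
  agree j u≡v with j Fin.≟ i
  ... | yes refl = contradiction u≡v differs
  ... | no j≢i   = lookup∘updateAt′ j i j≢i u

between-flipAtʳ : ∀ i → lookup u i ≢ lookup v i → Between u v (flipAt v i)
between-flipAtʳ i differs = between-sym (between-flipAt i (differs ∘ sym))

between⇒hamming : Between u v x → hamming u x + hamming x v ≡ hamming u v
between⇒hamming {u = []}    {[]}    {[]}    _             = refl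
between⇒hamming {u = a ∷ u} {b ∷ v} {c ∷ x} (between x∈I) =
  trans (interchange +-commutativeSemigroup (δ a c) (hamming u x) (δ c b) (hamming x v))
        (cong₂ _+_ (δ-between a b c (x∈I zero)) (between⇒hamming {u = u} {v} {x} (between (x∈I ∘ suc))))

hamming-between≤ : Between u v x → Between u v y → hamming x y ≤ hamming u v
hamming-between≤ {u = []}    {[]}    {[]}    {[]}    _             _             = z≤n
hamming-between≤ {u = a ∷ u} {b ∷ v} {c ∷ x} {d ∷ y} (between x∈I) (between y∈I) =
  +-mono-≤ (δ-between≤ a b c d (x∈I zero) (y∈I zero))
           (hamming-between≤ {u = u} {v} {x} {y} (between (x∈I ∘ suc)) (between (y∈I ∘ suc)))

corners : V h → V h → Fin h → List (V h)
corners u v i = u ∷ flipAt u i ∷ flipAt v i ∷ v ∷ []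

square-corners : ∀ i → lookup u i ≢ lookup v i → hamming u v ≡ 2 → Between u v x → x ∈ corners u v i
square-corners {u = u} {v} {x} i differs d≡2 x∈I =
  corner (hamming u x) refl (trans (between⇒hamming x∈I) d≡2)
  where
  corner : ∀ n → hamming u x ≡ n → n + hamming x v ≡ 2 → x ∈ corners u v i
  corner 0 ux≡0 _ = here (sym (hamming≡0⇒≡ u x ux≡0))
  corner 2 _ xv≡0 = there (there (there (here (hamming≡0⇒≡ x v (suc-injective (suc-injective xv≡0))))))
  corner (suc (suc (suc _))) _ ()
  corner 1 ux≡1 xv≡1 with lookup u i Bool.≟ lookup x i
  ... | no u≢x = there (here (sym (hamming≡0⇒≡ (flipAt u i) x flip-u-x≡0)))
    where
    flip-u-x≡0 : hamming (flipAt u i) x ≡ 0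
    flip-u-x≡0 = suc-injective (trans (sym (hamming-flipAt-≢ u x i u≢x)) ux≡1)
  ... | yes u≡x =
    there (there (here (trans (sym (flipAt-involutive x i)) (cong (λ t → flipAt t i) flip-x≡v))))
    where
    flip-x≡v : flipAt x i ≡ v
    flip-x≡v = hamming≡0⇒≡ (flipAt x i) v
      (suc-injective (trans (sym (hamming-flipAt-≢ x v i (differs ∘ trans u≡x))) (suc-injective xv≡1)))

square-midpoints : ∀ i → lookup u i ≢ lookup v i → hamming u v ≡ 2 →
                   Between u v x → x ≢ u → x ≢ v → x ≡ flipAt u i ⊎ x ≡ flipAt v i
square-midpoints i differs d≡2 x∈I x≢u x≢v with square-corners i differs d≡2 x∈I
... | here x≡u                         = contradiction x≡u x≢u
... | there (here x≡a)                 = inj₁ x≡a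
... | there (there (here x≡b))         = inj₂ x≡b
... | there (there (there (here x≡v))) = contradiction x≡v x≢v

opposite-square-interior : ∀ i → lookup w i ≢ lookup z i → hamming w z ≡ 2 →
                           Between (flipAt w i) (flipAt z i) x → x ≢ flipAt w i → x ≢ flipAt z i →
                           x ≡ w ⊎ x ≡ z
opposite-square-interior {w = w} {z} i differs d≡2 x∈I x≢w′ x≢z′
  with square-midpoints i differs′ (trans (hamming-flipAt-flipAt w z i) d≡2) x∈I x≢w′ x≢z′
  where
  differs′ : lookup (flipAt w i) i ≢ lookup (flipAt z i) i
  differs′ e = differs (not-injective (trans (sym (lookup∘updateAt i w)) (trans e (lookup∘updateAt i z))))
... | inj₁ x≡w = inj₁ (trans x≡w (flipAt-involutive w i))
... | inj₂ x≡z = inj₂ (trans x≡z (flipAt-involutive z i))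

Geodesic : {u v : V h} → Walk u v → Set
Geodesic {u = u} {v} p = length p ≡ hamming u v

hamming≤length : (p : Walk u v) → hamming u v ≤ length p
hamming≤length {u = u} [] = ≤-reflexive (hamming-refl u)
hamming≤length {u = u} {v} (_∷_ {w = w} adj p) =
  ≤-trans (hamming-Adj≤ {u = u} {w} {v} adj) (s≤s (hamming≤length p))

geodesic : (u v : V h) → Σ (Walk u v) Geodesic
geodesic u v = go (hamming u v) u refl
  where
  go : ∀ n u → hamming u v ≡ n → Σ (Walk u v) Geodesic
  go zero    u d≡0 with hamming≡0⇒≡ u v d≡0
  ... | refl = [] , sym (hamming-refl u)
  go (suc n) u d≡1+n = Adj-flipAt u i ∷ p , trans (cong suc g) (sym (hamming-flipAt-≢ u v i differs))
    where
    u≢v : u ≢ v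
    u≢v refl = 1+n≢0 (trans (sym d≡1+n) (hamming-refl u))
    i = proj₁ (differing-coordinate u≢v)
    differs = proj₂ (differing-coordinate u≢v)
    rest = go n (flipAt u i) (suc-injective (trans (sym (hamming-flipAt-≢ u v i differs)) d≡1+n))
    p = proj₁ rest
    g = proj₂ rest

shortest⇒geodesic : (p : Walk u v) → Shortest p → Geodesic p
shortest⇒geodesic {u = u} {v} p shortest =
  ≤-antisym (≤-trans (shortest (proj₁ (geodesic u v))) (≤-reflexive (proj₂ (geodesic u v)))) (hamming≤length p)

geodesic⇒shortest : (p : Walk u v) → Geodesic p → Shortest p
geodesic⇒shortest p g q = ≤-trans (≤-reflexive g) (hamming≤length q)

Dist⇒hamming : ∀ {n} → Dist u v n → hamming u v ≡ n
Dist⇒hamming (p , len , shortest) = trans (sym (shortest⇒geodesic p shortest)) len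

hamming⇒Dist : ∀ {n} → hamming u v ≡ n → Dist u v n
hamming⇒Dist {u = u} {v} d≡n with geodesic u v
... | p , g = p , trans g d≡n , geodesic⇒shortest p g

_++ʷ_ : Walk u w → Walk w v → Walk u v
[]        ++ʷ q = q
(adj ∷ p) ++ʷ q = adj ∷ (p ++ʷ q)

length-++ʷ : (p : Walk u w) (q : Walk w v) → length (p ++ʷ q) ≡ length p + length q
length-++ʷ []        q = refl
length-++ʷ (adj ∷ p) q = cong suc (length-++ʷ p q)

On-start : (p : Walk u v) → On u p
On-start []        = refl
On-start (adj ∷ p) = inj₁ refl

On-++ʷʳ : (p : Walk u w) {q : Walk w v} → On x q → On x (p ++ʷ q)
On-++ʷʳ []        x∈q = x∈q
On-++ʷʳ (adj ∷ p) x∈q = inj₂ (On-++ʷʳ p x∈q)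

geodesic-++ʷ : Between u v w → (p : Walk u w) (q : Walk w v) →
               Geodesic p → Geodesic q → Geodesic (p ++ʷ q)
geodesic-++ʷ w∈I p q gp gq = trans (length-++ʷ p q) (trans (cong₂ _+_ gp gq) (between⇒hamming w∈I))

geodesic-∷ : (adj : Adj u w) (q : Walk w v) → Geodesic (_∷_ {u = u} adj q) → Between u v w × Geodesic q
geodesic-∷ {u = u} {w} {v} adj q g with Adj⇒flipAt {u = u} {w} adj
... | i , refl with lookup u i Bool.≟ lookup v i
...   | no differs = between-flipAt i differs , suc-injective (trans g (hamming-flipAt-≢ u v i differs))
...   | yes same   = contradiction (hamming≤length q) (<⇒≱ (begin-strict
  length q               <⟨ n<1+n _ ⟩
  suc (length q)         ≡⟨ g ⟩
  hamming u v            <⟨ n<1+n _ ⟩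
  suc (hamming u v)      ≡⟨ sym (hamming-flipAt-≡ u v i same) ⟩
  hamming (flipAt u i) v ∎))
  where open ≤-Reasoning

geodesic⇒between : (p : Walk u v) → Geodesic p → On x p → Between u v x
geodesic⇒between []        _ refl        = between-left
geodesic⇒between (adj ∷ q) _ (inj₁ refl) = between-left
geodesic⇒between {u = u} (adj ∷ q) g (inj₂ x∈q) with geodesic-∷ {u = u} adj q g
... | w∈I , gq = between-convex w∈I between-right (geodesic⇒between q gq x∈q)

Between⇒InInterval : Between u v x → InInterval u v x
Between⇒InInterval {u = u} {v} {x} x∈I =
  p ++ʷ q , geodesic⇒shortest (p ++ʷ q) (geodesic-++ʷ x∈I p q gp gq) , On-++ʷʳ p (On-start q)
  where
  p = proj₁ (geodesic u x)
  gp = proj₂ (geodesic u x)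
  q = proj₁ (geodesic x v)
  gq = proj₂ (geodesic x v)

InInterval⇒Between : InInterval u v x → Between u v x
InInterval⇒Between (p , shortest , x∈p) = geodesic⇒between p (shortest⇒geodesic p shortest) x∈p

InIM? : (M : VSet h) (u v : V h) → Decidable (InIM M u v)
InIM? M u v x = map′ Between⇒InInterval InInterval⇒Between (between? u v x) ×-dec (M x Bool.≟ true)

FreeGeodesic : VSet h → V h → V h → Set
FreeGeodesic M u v = Σ (Walk u v) λ p → Geodesic p × Free M p

short-walk-free : ∀ (M : VSet h) (p : Walk u v) → length p ≤ 1 → Free M p
short-walk-free M []            _ = _
short-walk-free M (_ ∷ [])      _ = _
short-walk-free M (_ ∷ (_ ∷ _)) (s≤s ())

Free-++ʷ : ∀ (M : VSet h) (p : Walk u w) (q : Walk w v) →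
           Free M p → M w ≡ false → Free M q → Free M (p ++ʷ q)
Free-++ʷ M []                _       _               _   free-q = free-q
Free-++ʷ M (adj ∷ [])        []      _               _   _      = _
Free-++ʷ M (adj ∷ [])        (_ ∷ _) _               w∉M free-q = w∉M , free-q
Free-++ʷ M (adj ∷ p@(_ ∷ _)) q       (w′∉M , free-p) w∉M free-q = w′∉M , Free-++ʷ M p q free-p w∉M free-q

FreeGeodesic-++ʷ : ∀ {M : VSet h} → Between u v w → M w ≡ false →
                  FreeGeodesic M u w → FreeGeodesic M w v → FreeGeodesic M u v
FreeGeodesic-++ʷ {M = M} w∈I w∉M (p , gp , free-p) (q , gq , free-q) =
  p ++ʷ q , geodesic-++ʷ w∈I p q gp gq , Free-++ʷ M p q free-p w∉M free-q

free-geodesic-interior-edge : ∀ (M : VSet h) (q : Walk u v) → Geodesic q → Free M q → 3 ≤ length q →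
  ∃₂ λ p₁ p₂ → Adj p₁ p₂ × Between u v p₁ × Between u v p₂ × M p₁ ≡ false × M p₂ ≡ false
free-geodesic-interior-edge {u = u} M (_∷_ {w = p₁} adj₁ (_∷_ {w = p₂} adj₂ q@(_ ∷ _))) g
                            (p₁∉M , p₂∉M , _) _
  with geodesic-∷ {u = u} adj₁ (adj₂ ∷ q) g
... | p₁∈I , g₁ with geodesic-∷ {u = p₁} adj₂ q g₁
...   | p₂∈I₁ , _ = p₁ , p₂ , adj₂ , p₁∈I , between-convex p₁∈I between-right p₂∈I₁ , p₁∉M , p₂∉M
free-geodesic-interior-edge M (_ ∷ [])     _ _ (s≤s ())
free-geodesic-interior-edge M (_ ∷ _ ∷ []) _ _ (s≤s (s≤s ()))

interior⊆M⇒¬Visible : ∀ (M : VSet h) → 2 ≤ hamming u v →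
                      (∀ x → Between u v x → x ≢ u → x ≢ v → M x ≡ true) → ¬ Visible M u v
interior⊆M⇒¬Visible {u = u} {v} M 2≤d interior⊆M (p , shortest , free) =
  blocked p g (subst (2 ≤_) (sym g) 2≤d) free
  where
  g = shortest⇒geodesic p shortest
  blocked : (p : Walk u v) → Geodesic p → 2 ≤ length p → Free M p → ⊥
  blocked (_ ∷ []) _ (s≤s ()) _
  blocked (_∷_ {w = w} adj q@(_ ∷ _)) g _ (w∉M , _) =
    contradiction (trans (sym (interior⊆M w w∈I (≢-sym (Adj⇒≢ adj)) w≢v)) w∉M) λ ()
    where
    w∈I = proj₁ (geodesic-∷ {u = u} adj q g)
    w≢v : w ≢ v
    w≢v refl = 2≤hamming⇒¬Adj {u = u} 2≤d adj

edge-avoids-pair : Adj x y → ¬ Adj u v → (x ≢ u × x ≢ v) ⊎ (y ≢ u × y ≢ v)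
edge-avoids-pair {x = x} {y} {u = u} {v} adj ¬uv with x ≟ᵥ u | x ≟ᵥ v
... | no x≢u   | no x≢v   = inj₁ (x≢u , x≢v)
... | yes refl | _        = inj₂ ((λ { refl → Adj⇒≢ {u = x} adj refl }) , λ { refl → ¬uv adj })
... | no _     | yes refl =
  inj₂ ((λ { refl → ¬uv (Adj-sym {u = v} {u} adj) }) , λ { refl → Adj⇒≢ {u = x} adj refl })

IsEdgePair⇒Adj : {S : V h → Set} → IsEdgePair S → S x → S y → x ≢ y → Adj x y
IsEdgePair⇒Adj {x = x} {y} (w , z , adj , S⇔wz) sx sy x≢y with to (S⇔wz x) sx | to (S⇔wz y) sy
... | inj₁ refl | inj₁ refl = contradiction refl x≢y
... | inj₁ refl | inj₂ refl = adj
... | inj₂ refl | inj₁ refl = Adj-sym {u = w} {z} adj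
... | inj₂ refl | inj₂ refl = contradiction refl x≢y

SquareCondition : VSet h → Set
SquareCondition M = ∀ u v → Dist u v 2 → ¬ HasTwo (InIM M u v) ⊎ IsEdgePair (InIM M u v)

nonadjacent-pair⇒blocked-diagonal :
  ∀ (M : VSet h) → hamming u v ≡ 2 → (∀ x → InIM M u v x ⇔ (x ≡ w ⊎ x ≡ z)) → w ≢ z → ¬ Adj w z →
  ∃₂ λ a b → M a ≡ false × M b ≡ false × ¬ Visible M a b
nonadjacent-pair⇒blocked-diagonal {u = u} {v} {w} {z} M d≡2 S⇔wz w≢z ¬adj =
  a , b , outside a∈I a≢w a≢z , outside b∈I b≢w b≢z ,
  interior⊆M⇒¬Visible M (≤-reflexive (sym ab≡2)) interior⊆M
  where
  w∈S = from (S⇔wz w) (inj₁ refl)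
  z∈S = from (S⇔wz z) (inj₂ refl)
  w∈I = InInterval⇒Between (proj₁ w∈S)
  z∈I = InInterval⇒Between (proj₁ z∈S)
  wz≡2 : hamming w z ≡ 2
  wz≡2 = ≤-antisym (subst (hamming w z ≤_) d≡2 (hamming-between≤ w∈I z∈I))
                   (≤∧≢⇒< (n≢0⇒n>0 (w≢z ∘ hamming≡0⇒≡ w z)) (¬adj ∘ hamming≡1⇒Adj {u = w} {z} ∘ sym))
  i = proj₁ (differing-coordinate w≢z)
  differs = proj₂ (differing-coordinate w≢z)
  a = flipAt w i
  b = flipAt z i
  ab≡2 : hamming a b ≡ 2
  ab≡2 = trans (hamming-flipAt-flipAt w z i) wz≡2
  a∈I : Between u v a
  a∈I = between-convex w∈I z∈I (between-flipAt i differs)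
  b∈I : Between u v b
  b∈I = between-convex w∈I z∈I (between-flipAtʳ i differs)
  a≢w : a ≢ w
  a≢w = ≢-sym (Adj⇒≢ (Adj-flipAt w i))
  a≢z : a ≢ z
  a≢z a≡z = ¬adj (subst (Adj w) a≡z (Adj-flipAt w i))
  b≢z : b ≢ z
  b≢z = ≢-sym (Adj⇒≢ (Adj-flipAt z i))
  b≢w : b ≢ w
  b≢w b≡w = ¬adj (Adj-sym {u = z} {w} (subst (Adj z) b≡w (Adj-flipAt z i)))
  outside : ∀ {t} → Between u v t → t ≢ w → t ≢ z → M t ≡ false
  outside t∈I t≢w t≢z = ¬-not λ t∈M → [ t≢w , t≢z ]′ (to (S⇔wz _) (Between⇒InInterval t∈I , t∈M))
  interior⊆M : ∀ t → Between a b t → t ≢ a → t ≢ b → M t ≡ true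
  interior⊆M t t∈J t≢a t≢b with opposite-square-interior i differs wz≡2 t∈J t≢a t≢b
  ... | inj₁ refl = proj₂ w∈S
  ... | inj₂ refl = proj₂ z∈S

dual⇒squareCondition : {M : VSet h} → DualMutualVisibility M → SquareCondition M
dual⇒squareCondition {M = M} (_ , outside-visible) u v dist₂ =
  decide (hasTwo? (cardinality _≟ᵥ_ S (InIM? M u v) (corners u v i) S⊆corners))
  where
  S = InIM M u v
  d≡2 = Dist⇒hamming dist₂
  u≢v : u ≢ v
  u≢v refl = 1+n≢0 (trans (sym d≡2) (hamming-refl u))
  i = proj₁ (differing-coordinate u≢v)
  differs = proj₂ (differing-coordinate u≢v)
  S⊆corners : ∀ x → S x → x ∈ corners u v i
  S⊆corners x (x∈I , _) = square-corners i differs d≡2 (InInterval⇒Between x∈I)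
  decide : Dec (HasTwo S) → ¬ HasTwo S ⊎ IsEdgePair S
  decide (no ¬two) = inj₁ ¬two
  decide (yes (w , z , w≢z , S⇔wz)) with adjacent? w z
  ... | yes adj = inj₂ (w , z , adj , S⇔wz)
  ... | no ¬adj with nonadjacent-pair⇒blocked-diagonal M d≡2 S⇔wz w≢z ¬adj
  ...   | a , b , a∉M , b∉M , ¬visible = contradiction (outside-visible a b a∉M b∉M) ¬visible

squareCondition⇒¬midpoints∈M : {M : VSet h} → SquareCondition M → ∀ i → lookup u i ≢ lookup v i →
                               hamming u v ≡ 2 → M u ≡ false → M v ≡ false →
                               M (flipAt u i) ≡ true → M (flipAt v i) ≡ true → ⊥
squareCondition⇒¬midpoints∈M {u = u} {v} {M = M} cond i differs d≡2 u∉M v∉M a∈M b∈M =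
  decide (cond u v (hamming⇒Dist d≡2))
  where
  a = flipAt u i
  b = flipAt v i
  ab≡2 : hamming a b ≡ 2
  ab≡2 = trans (hamming-flipAt-flipAt u v i) d≡2
  a≢b : a ≢ b
  a≢b a≡b = contradiction (trans (sym ab≡2) (trans (cong (hamming a) (sym a≡b)) (hamming-refl a))) λ ()
  ∈M⇒≢ : ∀ {x t} → M x ≡ true → M t ≡ false → x ≢ t
  ∈M⇒≢ x∈M t∉M refl = contradiction (trans (sym x∈M) t∉M) λ ()
  S⇔ab : ∀ x → InIM M u v x ⇔ (x ≡ a ⊎ x ≡ b)
  S⇔ab x = mk⇔
    (λ (x∈I , x∈M) →
      square-midpoints i differs d≡2 (InInterval⇒Between x∈I) (∈M⇒≢ x∈M u∉M) (∈M⇒≢ x∈M v∉M))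
    λ { (inj₁ refl) → Between⇒InInterval (between-flipAt i differs) , a∈M
      ; (inj₂ refl) → Between⇒InInterval (between-flipAtʳ i differs) , b∈M }
  decide : ¬ HasTwo (InIM M u v) ⊎ IsEdgePair (InIM M u v) → ⊥
  decide (inj₁ ¬two) = ¬two (a , b , a≢b , S⇔ab)
  decide (inj₂ edge) = 2≤hamming⇒¬Adj {u = a} {b} (≤-reflexive (sym ab≡2))
    (IsEdgePair⇒Adj edge (from (S⇔ab a) (inj₁ refl)) (from (S⇔ab b) (inj₂ refl)) a≢b)

InteriorOutside : VSet h → V h → V h → V h → Set
InteriorOutside M u v w = Between u v w × w ≢ u × w ≢ v × M w ≡ false

outside-interior-vertex : {M : VSet h} → MutualVisibility M → SquareCondition M →
  2 ≤ hamming u v → M u ≡ false → M v ≡ false → ∃ (InteriorOutside M u v)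
outside-interior-vertex {u = u} {v} {M = M} mv cond 2≤d u∉M v∉M = result
  where
  u≢v : u ≢ v
  u≢v refl = contradiction (subst (2 ≤_) (hamming-refl u) 2≤d) λ ()
  i = proj₁ (differing-coordinate u≢v)
  differs = proj₂ (differing-coordinate u≢v)
  a = flipAt u i
  b = flipAt v i
  a≢u : a ≢ u
  a≢u = ≢-sym (Adj⇒≢ (Adj-flipAt u i))
  a≢v : a ≢ v
  a≢v a≡v = 2≤hamming⇒¬Adj {u = u} 2≤d (subst (Adj u) a≡v (Adj-flipAt u i))
  b≢v : b ≢ v
  b≢v = ≢-sym (Adj⇒≢ (Adj-flipAt v i))
  b≢u : b ≢ u
  b≢u b≡u = 2≤hamming⇒¬Adj {u = u} 2≤d (Adj-sym {u = v} {u} (subst (Adj v) b≡u (Adj-flipAt v i)))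
  a∈I : Between u v a
  a∈I = between-flipAt i differs
  b∈I : Between u v b
  b∈I = between-flipAtʳ i differs
  far : 3 ≤ hamming u v → Visible M a b → ∃ (InteriorOutside M u v)
  far 3≤d (q , shortest , free) with free-geodesic-interior-edge M q g free 3≤length
    where
    g = shortest⇒geodesic q shortest
    3≤length = subst (3 ≤_) (sym (trans g (hamming-flipAt-flipAt u v i))) 3≤d
  ... | p₁ , p₂ , adj , p₁∈J , p₂∈J , p₁∉M , p₂∉M with edge-avoids-pair adj (2≤hamming⇒¬Adj {u = u} 2≤d)
  ...   | inj₁ (p₁≢u , p₁≢v) = p₁ , between-convex a∈I b∈I p₁∈J , p₁≢u , p₁≢v , p₁∉M
  ...   | inj₂ (p₂≢u , p₂≢v) = p₂ , between-convex a∈I b∈I p₂∈J , p₂≢u , p₂≢v , p₂∉M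
  result : ∃ (InteriorOutside M u v)
  result with M a in a∈M | M b in b∈M
  ... | false | _     = a , a∈I , a≢u , a≢v , a∈M
  ... | true  | false = b , b∈I , b≢u , b≢v , b∈M
  ... | true  | true  with m≤n⇒m<n∨m≡n 2≤d
  ...   | inj₂ 2≡d = ⊥-elim (squareCondition⇒¬midpoints∈M cond i differs (sym 2≡d) u∉M v∉M a∈M b∈M)
  ...   | inj₁ 3≤d = far 3≤d (mv a b a∈M b∈M)

outside-free-geodesic : {M : VSet h} → MutualVisibility M → SquareCondition M →
                        M u ≡ false → M v ≡ false → FreeGeodesic M u v
outside-free-geodesic {h = h} {u = u} {v} {M = M} mv cond = <-rec P step (hamming u v) refl
  where
  P : ℕ → Set
  P n = ∀ {u v : V h} → hamming u v ≡ n → M u ≡ false → M v ≡ false → FreeGeodesic M u v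
  step : ∀ n → (∀ {m} → m < n → P m) → P n
  step _ rec {u} {v} refl u∉M v∉M with hamming u v ≤? 1
  ... | yes d≤1 = p , g , short-walk-free M p (≤-trans (≤-reflexive g) d≤1)
    where
    p = proj₁ (geodesic u v)
    g = proj₂ (geodesic u v)
  ... | no d≰1 with outside-interior-vertex mv cond (≰⇒> d≰1) u∉M v∉M
  ...   | w , w∈I , w≢u , w≢v , w∉M =
    FreeGeodesic-++ʷ w∈I w∉M (rec uw<uv refl u∉M w∉M) (rec wv<uv refl w∉M v∉M)
    where
    uw<uv : hamming u w < hamming u v
    uw<uv = subst (hamming u w <_) (between⇒hamming w∈I) (m<m+n _ (n≢0⇒n>0 (w≢v ∘ hamming≡0⇒≡ w v)))
    wv<uv : hamming w v < hamming u v
    wv<uv = subst (hamming w v <_) (between⇒hamming w∈I) (m<n+m _ (n≢0⇒n>0 (w≢u ∘ sym ∘ hamming≡0⇒≡ u w)))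

squareCondition⇒dual : {M : VSet h} → MutualVisibility M → SquareCondition M → DualMutualVisibility M
squareCondition⇒dual mv cond = mv , λ u v u∉M v∉M →
  let (p , g , free) = outside-free-geodesic mv cond u∉M v∉M in p , geodesic⇒shortest p g , free

proposition3p13 : (h : ℕ) (M : VSet h) → MutualVisibility M →
    DualMutualVisibility M ⇔
      (∀ u v → Dist u v 2 →
        ¬ HasTwo (InIM M u v) ⊎ IsEdgePair (InIM M u v))
proposition3p13 h M mv = mk⇔ dual⇒squareCondition (squareCondition⇒dual mv)
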